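{- Let $s,t,n$ be positive integers. The number of lattice paths from $(0,0)$ to $(sn-1,tn-1)$ lying weakly beneath $\mathsf{U}^{t-1}(\mathsf{R}^s\mathsf{U}^t)^{n-1}\mathsf{R}^{s-1}$ is $$\frac{1}{n}\binom{(s+t)n-2}{tn-1}.$$
   Context: Lattice paths use unit steps $(0,1)$ (up, $\mathsf{U}$) and $(1,0)$ (right, $\mathsf{R}$); a word in $\mathsf{U},\mathsf{R}$ describes a lattice path from $(0,0)$ (exponents denote repetition). A lattice path $P$ from $(0,0)$ lies weakly beneath the staircase path $S$ if $P$ has at most as many up steps as $S$ and, for each $r$, the $r$-th up step of $P$ has $x$-coordinate at least that of the $r$-th up step of $S$. -}

module Defs where

open import Data.Nat using (ℕ; zero; suc; _+_; _*_; _∸_; _≤_)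
open import Data.List using (List; []; _∷_; _++_; replicate; concat; length)
open import Data.Product using (_×_)
open import Data.Unit using (⊤)
open import Data.Empty using (⊥)
open import Relation.Binary.PropositionalEquality using (_≡_)

-- unit steps: U = (0,1) (up), R = (1,0) (right)
data Step : Set where
  U R : Step

-- a lattice path from (0,0), given by its word of steps
Path : Set
Path = List Step

-- number of right steps / up steps; the endpoint of p is (#R p , #U p)
#R : Path → ℕ
#R []       = 0
#R (R ∷ p)  = suc (#R p)
#R (U ∷ p)  = #R p

#U : Path → ℕ
#U []       = 0
#U (U ∷ p)  = suc (#U p)
#U (R ∷ p)  = #U p

EndsAt : Path → ℕ → ℕ → Set
EndsAt p a b = (#R p ≡ a) × (#U p ≡ b)

upXsFrom : ℕ → Path → List ℕ
upXsFrom x []       = []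
upXsFrom x (U ∷ p)  = x ∷ upXsFrom x p
upXsFrom x (R ∷ p)  = upXsFrom (suc x) p

upXs : Path → List ℕ
upXs = upXsFrom 0

_≼_ : List ℕ → List ℕ → Set
[]       ≼ ys       = ⊤
(x ∷ xs) ≼ []       = ⊥
(x ∷ xs) ≼ (y ∷ ys) = (y ≤ x) × (xs ≼ ys)

WeaklyBeneath : Path → Path → Set
WeaklyBeneath P S = upXs P ≼ upXs S

staircase : ℕ → ℕ → ℕ → Path
staircase s t n =
  replicate (t ∸ 1) U
  ++ concat (replicate (n ∸ 1) (replicate s R ++ replicate t U))
  ++ replicate (s ∸ 1) R

-- Put a = sn-1, b = tn-1 and let A be the list of all C(a+b, b) paths from (0,0)
-- to (a, b).  Cutting P ∈ A at its up steps number t, 2t, ..., (n-1)t splits it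
-- into n chunks with t-1 up steps each; write w₀, ..., w_{n-1} for their numbers
-- of right steps, so that w₀ + ... + w_{n-1} = sn - 1.  Comparing the up steps of
-- P with those of the staircase chunk by chunk shows that P lies weakly beneath
-- it iff every proper prefix sum satisfies w₀ + ... + w_{j-1} ≥ sj (0 < j < n).
--
-- Cyclically rotating the chunks defines a permutation ρ of A with ρⁿ = id.  By
-- the cycle lemma, since the weights sum to sn - 1, exactly one of the n
-- rotations of (w₀, ..., w_{n-1}) has this prefix property, namely the one
-- starting at the first minimum of j ↦ w₀ + ... + w_{j-1} - sj.  So every window
-- P, ρP, ..., ρ^{n-1}P contains exactly one path beneath the staircase, and a
-- double count of such windows gives  n · #(paths beneath) = #A = C(a+b, b).

module Submission where

open import Defs
open import Data.Nat using (ℕ; zero; suc; _+_; _*_; _∸_; _≤_; _<_; _≤?_; z≤n; s≤s; NonZero)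
open import Data.Nat.Properties
open import Data.Nat.Tactic.RingSolver using (solve-∀)
open import Data.Nat.Combinatorics using (_C_; nCn≡1; nCk+nC[k+1]≡[n+1]C[k+1])
open import Data.Nat.ListAction using (sum)
open import Data.Nat.ListAction.Properties using (sum-++)
open import Data.List using (List; []; _∷_; _++_; [_]; length; map; filter; take; replicate; concat)
open import Data.List.Properties
  using (length-++; length-map; length-replicate; ++-assoc; ++-identityʳ; map-++; take-all; ∷-injectiveʳ)
open import Data.List.Relation.Unary.Unique.Propositional using (Unique)
import Data.List.Relation.Unary.Unique.Propositional.Properties as Unique
open import Data.List.Relation.Unary.All as All using (All; []; _∷_)
import Data.List.Relation.Unary.All.Properties as All
import Data.List.Relation.Unary.AllPairs as AllPairs
open import Data.List.Relation.Unary.Any using (here; there)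
open import Data.List.Membership.Propositional using (_∈_)
open import Data.List.Membership.Propositional.Properties
  using (∈-++⁺ˡ; ∈-++⁺ʳ; ∈-++⁻; ∈-map⁺; ∈-map⁻; ∈-filter⁺; ∈-filter⁻)
open import Data.List.Membership.Propositional.Properties.WithK using (unique∧set⇒bag)
open import Data.List.Relation.Binary.BagAndSetEquality using (∼bag⇒↭)
open import Data.List.Relation.Binary.Permutation.Propositional.Properties using (↭-length)
open import Data.List.Relation.Binary.Disjoint.Propositional using (Disjoint)
open import Data.Product using (Σ; _×_; _,_; proj₁; proj₂; map₁)
open import Data.Sum using (inj₁; inj₂)
open import Data.Unit using (tt)
open import Data.Empty using (⊥-elim)
open import Function.Bundles using (_⇔_; mk⇔; module Equivalence)
import Function.Properties.Equivalence as ⇔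
open import Relation.Nullary using (Dec; yes; no; ¬_)
open import Relation.Nullary.Decidable using (_×-dec_)
open import Relation.Unary using (Decidable; Pred)
open import Level using (0ℓ)
open import Relation.Binary.Definitions using (tri<; tri≈; tri>)
open import Relation.Binary.PropositionalEquality
  using (_≡_; refl; sym; trans; cong; cong₂; subst; module ≡-Reasoning)

open Equivalence using (to; from)

paths : ℕ → ℕ → List Path
paths zero    zero    = [ [] ]
paths zero    (suc b) = map (U ∷_) (paths zero b)
paths (suc a) zero    = map (R ∷_) (paths a zero)
paths (suc a) (suc b) = map (R ∷_) (paths a (suc b)) ++ map (U ∷_) (paths (suc a) b)

paths-unique : ∀ a b → Unique (paths a b)
paths-unique zero    zero    = [] AllPairs.∷ AllPairs.[]
paths-unique zero    (suc b) = Unique.map⁺ ∷-injectiveʳ (paths-unique zero b)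
paths-unique (suc a) zero    = Unique.map⁺ ∷-injectiveʳ (paths-unique a zero)
paths-unique (suc a) (suc b) =
  Unique.++⁺ (Unique.map⁺ ∷-injectiveʳ (paths-unique a (suc b)))
             (Unique.map⁺ ∷-injectiveʳ (paths-unique (suc a) b)) R-and-U-disjoint
  where
  R-and-U-disjoint : Disjoint (map (R ∷_) (paths a (suc b))) (map (U ∷_) (paths (suc a) b))
  R-and-U-disjoint (p , q) with ∈-map⁻ (R ∷_) p | ∈-map⁻ (U ∷_) q
  ... | _ , _ , refl | _ , _ , ()

paths-sound : ∀ a b {P} → P ∈ paths a b → EndsAt P a b
paths-sound zero zero (here refl) = refl , refl
paths-sound zero (suc b) P∈ with ∈-map⁻ (U ∷_) P∈
... | Q , Q∈ , refl = let (e₁ , e₂) = paths-sound zero b Q∈ in e₁ , cong suc e₂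
paths-sound (suc a) zero P∈ with ∈-map⁻ (R ∷_) P∈
... | Q , Q∈ , refl = let (e₁ , e₂) = paths-sound a zero Q∈ in cong suc e₁ , e₂
paths-sound (suc a) (suc b) P∈ with ∈-++⁻ (map (R ∷_) (paths a (suc b))) P∈
... | inj₁ P∈ᴿ with ∈-map⁻ (R ∷_) P∈ᴿ
...   | Q , Q∈ , refl = let (e₁ , e₂) = paths-sound a (suc b) Q∈ in cong suc e₁ , e₂
paths-sound (suc a) (suc b) P∈ | inj₂ P∈ᵁ with ∈-map⁻ (U ∷_) P∈ᵁ
...   | Q , Q∈ , refl = let (e₁ , e₂) = paths-sound (suc a) b Q∈ in e₁ , cong suc e₂

path∈paths : ∀ P → P ∈ paths (#R P) (#U P)
path∈paths [] = here refl
path∈paths (U ∷ P) with #R P | path∈paths P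
... | zero  | P∈ = ∈-map⁺ (U ∷_) P∈
... | suc a | P∈ = ∈-++⁺ʳ (map (R ∷_) (paths a (suc (#U P)))) (∈-map⁺ (U ∷_) P∈)
path∈paths (R ∷ P) with #U P | path∈paths P
... | zero  | P∈ = ∈-map⁺ (R ∷_) P∈
... | suc b | P∈ = ∈-++⁺ˡ (∈-map⁺ (R ∷_) P∈)

paths-complete : ∀ {a b} P → EndsAt P a b → P ∈ paths a b
paths-complete P (refl , refl) = path∈paths P

-- Pascal's rule on both sides
paths-length : ∀ a b → length (paths a b) ≡ (a + b) C b
paths-length zero zero = refl
paths-length zero (suc b) =
  trans (length-map (U ∷_) (paths zero b)) (trans (paths-length zero b) (trans (nCn≡1 b) (sym (nCn≡1 (suc b)))))
paths-length (suc a) zero = trans (length-map (R ∷_) (paths a zero)) (paths-length a zero)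
paths-length (suc a) (suc b) = begin
    length (map (R ∷_) (paths a (suc b)) ++ map (U ∷_) (paths (suc a) b))
  ≡⟨ length-++ (map (R ∷_) (paths a (suc b))) ⟩
    length (map (R ∷_) (paths a (suc b))) + length (map (U ∷_) (paths (suc a) b))
  ≡⟨ cong₂ _+_ (length-map (R ∷_) (paths a (suc b))) (length-map (U ∷_) (paths (suc a) b)) ⟩
    length (paths a (suc b)) + length (paths (suc a) b)
  ≡⟨ cong₂ _+_ (paths-length a (suc b)) (paths-length (suc a) b) ⟩
    (a + suc b) C suc b + (suc a + b) C b
  ≡⟨ cong (λ m → m C suc b + (suc a + b) C b) (+-suc a b) ⟩
    (suc a + b) C suc b + (suc a + b) C b
  ≡⟨ +-comm ((suc a + b) C suc b) _ ⟩
    (suc a + b) C b + (suc a + b) C suc b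
  ≡⟨ nCk+nC[k+1]≡[n+1]C[k+1] (suc a + b) b ⟩
    suc (suc a + b) C suc b
  ≡⟨ cong (λ m → suc m C suc b) (sym (+-suc a b)) ⟩
    (suc a + suc b) C suc b ∎
  where open ≡-Reasoning

iter : {X : Set} → (X → X) → ℕ → X → X
iter f zero    x = x
iter f (suc k) x = iter f k (f x)

iter-commute : ∀ {X : Set} (f : X → X) k x → f (iter f k x) ≡ iter f k (f x)
iter-commute f zero    x = refl
iter-commute f (suc k) x = iter-commute f k (f x)

iter-natural : ∀ {X Y : Set} (g : X → Y) (f : X → X) (f′ : Y → Y) → (∀ x → g (f x) ≡ f′ (g x)) →
  ∀ k x → g (iter f k x) ≡ iter f′ k (g x)
iter-natural g f f′ comm zero    x = refl
iter-natural g f f′ comm (suc k) x = trans (iter-natural g f f′ comm k (f x)) (cong (iter f′ k) (comm x))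

rot : {X : Set} → List X → List X
rot []       = []
rot (x ∷ xs) = xs ++ [ x ]

length-rot : ∀ {X : Set} (xs : List X) → length (rot xs) ≡ length xs
length-rot []       = refl
length-rot (x ∷ xs) = trans (length-++ xs) (+-comm (length xs) 1)

sum-rot : ∀ (v : List ℕ) → sum (rot v) ≡ sum v
sum-rot []       = refl
sum-rot (x ∷ xs) = trans (sum-++ xs [ x ]) (trans (cong (sum xs +_) (+-identityʳ x)) (+-comm (sum xs) x))

map-rot : ∀ {X Y : Set} (f : X → Y) xs → map f (rot xs) ≡ rot (map f xs)
map-rot f []       = refl
map-rot f (x ∷ xs) = map-++ f xs [ x ]

All-rot : ∀ {X : Set} {P : Pred X 0ℓ} {xs} → All P xs → All P (rot xs)
All-rot []         = []
All-rot (px ∷ pxs) = All.++⁺ pxs (px ∷ [])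

take-++ˡ : ∀ {X : Set} j (ys zs : List X) → j ≤ length ys → take j (ys ++ zs) ≡ take j ys
take-++ˡ zero    ys       zs _         = refl
take-++ˡ (suc j) (y ∷ ys) zs (s≤s j≤n) = cong (y ∷_) (take-++ˡ j ys zs j≤n)

iter-rot-++ : ∀ {X : Set} k (xs ys : List X) → length xs ≡ k → iter rot k (xs ++ ys) ≡ ys ++ xs
iter-rot-++ zero    []       ys refl = sym (++-identityʳ ys)
iter-rot-++ (suc k) (x ∷ xs) ys e    = begin
    iter rot k ((xs ++ ys) ++ [ x ])  ≡⟨ cong (iter rot k) (++-assoc xs ys [ x ]) ⟩
    iter rot k (xs ++ (ys ++ [ x ]))  ≡⟨ iter-rot-++ k xs (ys ++ [ x ]) (suc-injective e) ⟩
    (ys ++ [ x ]) ++ xs              ≡⟨ ++-assoc ys [ x ] xs ⟩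
    ys ++ x ∷ xs                     ∎
  where open ≡-Reasoning

iter-rot-length : ∀ {X : Set} (xs : List X) → iter rot (length xs) xs ≡ xs
iter-rot-length xs = trans (cong (iter rot (length xs)) (sym (++-identityʳ xs))) (iter-rot-++ (length xs) xs [] refl)

sumBelow : ℕ → (ℕ → ℕ) → ℕ
sumBelow zero    f = 0
sumBelow (suc n) f = sumBelow n f + f n

sumBelow-cong : ∀ n {f g} → (∀ k → f k ≡ g k) → sumBelow n f ≡ sumBelow n g
sumBelow-cong zero    f≗g = refl
sumBelow-cong (suc n) f≗g = cong₂ _+_ (sumBelow-cong n f≗g) (f≗g n)

sumBelow-+ : ∀ n f g → sumBelow n (λ k → f k + g k) ≡ sumBelow n f + sumBelow n g
sumBelow-+ zero    f g = refl
sumBelow-+ (suc n) f g = trans (cong (_+ (f n + g n)) (sumBelow-+ n f g)) (interchange (sumBelow n f) (sumBelow n g) (f n) (g n))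
  where
  interchange : ∀ a b c d → a + b + (c + d) ≡ a + c + (b + d)
  interchange = solve-∀

sumBelow-const : ∀ n c → sumBelow n (λ _ → c) ≡ n * c
sumBelow-const zero    c = refl
sumBelow-const (suc n) c = trans (cong (_+ c) (sumBelow-const n c)) (+-comm (n * c) c)

sumBelow-zero : ∀ n f → (∀ k → k < n → f k ≡ 0) → sumBelow n f ≡ 0
sumBelow-zero zero    f f≡0 = refl
sumBelow-zero (suc n) f f≡0 = cong₂ _+_ (sumBelow-zero n f (λ k k<n → f≡0 k (m<n⇒m<1+n k<n))) (f≡0 n ≤-refl)

indicator : {P : Set} → Dec P → ℕ
indicator (yes _) = 1
indicator (no _)  = 0

indicator-yes : ∀ {P : Set} (P? : Dec P) → P → indicator P? ≡ 1
indicator-yes (yes _) _  = refl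
indicator-yes (no ¬p) p  = ⊥-elim (¬p p)

indicator-no : ∀ {P : Set} (P? : Dec P) → ¬ P → indicator P? ≡ 0
indicator-no (yes p) ¬p = ⊥-elim (¬p p)
indicator-no (no _)  _  = refl

ExactlyOneBelow : ℕ → (ℕ → Set) → Set
ExactlyOneBelow n P = Σ ℕ λ m → m < n × P m × (∀ k → k < n → P k → k ≡ m)

count-exactly-one : ∀ {P : ℕ → Set} (P? : ∀ k → Dec (P k)) n →
  ExactlyOneBelow n P → sumBelow n (λ k → indicator (P? k)) ≡ 1
count-exactly-one P? (suc n) (m , m<1+n , Pm , only-m) with m<1+n⇒m<n∨m≡n m<1+n
... | inj₁ m<n = cong₂ _+_ (count-exactly-one P? n (m , m<n , Pm , λ k k<n → only-m k (m<n⇒m<1+n k<n)))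
                           (indicator-no (P? n) (λ Pn → <-irrefl (sym (only-m n ≤-refl Pn)) m<n))
... | inj₂ refl = cong₂ _+_ (sumBelow-zero m _ λ k k<m → indicator-no (P? k) (λ Pk → <-irrefl (only-m k (m<n⇒m<1+n k<m) Pk) k<m))
                            (indicator-yes (P? m) Pm)

module _ {X : Set} where

  length-filter-∷ : ∀ {Q : Pred X 0ℓ} (Q? : Decidable Q) x xs →
    length (filter Q? (x ∷ xs)) ≡ indicator (Q? x) + length (filter Q? xs)
  length-filter-∷ Q? x xs with Q? x
  ... | yes _ = refl
  ... | no _  = refl

  count-by-parts : ∀ {Q : ℕ → Pred X 0ℓ} (Q? : ∀ k → Decidable (Q k)) n (A : List X) →
    (∀ {x} → x ∈ A → sumBelow n (λ k → indicator (Q? k x)) ≡ 1) →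
    sumBelow n (λ k → length (filter (Q? k) A)) ≡ length A
  count-by-parts Q? n [] one = sumBelow-zero n _ (λ _ _ → refl)
  count-by-parts Q? n (x ∷ A) one = begin
      sumBelow n (λ k → length (filter (Q? k) (x ∷ A)))
    ≡⟨ sumBelow-cong n (λ k → length-filter-∷ (Q? k) x A) ⟩
      sumBelow n (λ k → indicator (Q? k x) + length (filter (Q? k) A))
    ≡⟨ sumBelow-+ n _ _ ⟩
      sumBelow n (λ k → indicator (Q? k x)) + sumBelow n (λ k → length (filter (Q? k) A))
    ≡⟨ cong₂ _+_ (one (here refl)) (count-by-parts Q? n A (λ x∈ → one (there x∈))) ⟩
      suc (length A) ∎
    where open ≡-Reasoning

  unique-map-on : ∀ {Y : Set} (f : X → Y) {xs : List X} →
    (∀ {x y} → x ∈ xs → y ∈ xs → f x ≡ f y → x ≡ y) → Unique xs → Unique (map f xs)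
  unique-map-on f inj AllPairs.[] = AllPairs.[]
  unique-map-on f inj (x∉xs AllPairs.∷ u) =
    All.map⁺ (All.tabulate λ y∈ fx≡fy → All.lookup x∉xs y∈ (inj (here refl) (there y∈) fx≡fy))
    AllPairs.∷ unique-map-on f (λ x∈ y∈ → inj (there x∈) (there y∈)) u

module Permutation {X : Set} (A : List X) (unique-A : Unique A) (ρ σ : X → X)
    (ρ-closed : ∀ {x} → x ∈ A → ρ x ∈ A) (σ-closed : ∀ {x} → x ∈ A → σ x ∈ A)
    (σ-ρ : ∀ {x} → x ∈ A → σ (ρ x) ≡ x) (ρ-σ : ∀ {x} → x ∈ A → ρ (σ x) ≡ x) where

  -- ρ maps the elements of A satisfying Q ∘ ρ bijectively onto those satisfying Q
  filter-length-invariant : ∀ {Q : Pred X 0ℓ} (Q? : Decidable Q) →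
    length (filter (λ x → Q? (ρ x)) A) ≡ length (filter Q? A)
  filter-length-invariant {Q} Q? =
    trans (sym (length-map ρ B)) (↭-length (∼bag⇒↭ (unique∧set⇒bag unique-ρB unique-target (mk⇔ into onto))))
    where
    B : List X
    B = filter (λ x → Q? (ρ x)) A
    B⊆A : ∀ {x} → x ∈ B → x ∈ A
    B⊆A x∈ = proj₁ (∈-filter⁻ (λ x → Q? (ρ x)) x∈)
    unique-ρB : Unique (map ρ B)
    unique-ρB = unique-map-on ρ (λ x∈ y∈ ρx≡ρy → trans (sym (σ-ρ (B⊆A x∈))) (trans (cong σ ρx≡ρy) (σ-ρ (B⊆A y∈))))
                              (Unique.filter⁺ (λ x → Q? (ρ x)) unique-A)
    unique-target : Unique (filter Q? A)
    unique-target = Unique.filter⁺ Q? unique-A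
    into : ∀ {y} → y ∈ map ρ B → y ∈ filter Q? A
    into y∈ with ∈-map⁻ ρ y∈
    ... | x , x∈ , refl = let (x∈A , Qρx) = ∈-filter⁻ (λ x → Q? (ρ x)) x∈ in ∈-filter⁺ Q? (ρ-closed x∈A) Qρx
    onto : ∀ {y} → y ∈ filter Q? A → y ∈ map ρ B
    onto y∈ with ∈-filter⁻ Q? y∈
    ... | y∈A , Qy = subst (_∈ map ρ B) (ρ-σ y∈A)
          (∈-map⁺ ρ (∈-filter⁺ (λ x → Q? (ρ x)) (σ-closed y∈A) (subst Q (sym (ρ-σ y∈A)) Qy)))

  filter-length-iter : ∀ {Q : Pred X 0ℓ} (Q? : Decidable Q) k →
    length (filter (λ x → Q? (iter ρ k x)) A) ≡ length (filter Q? A)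
  filter-length-iter Q? zero    = refl
  filter-length-iter Q? (suc k) = trans (filter-length-invariant (λ x → Q? (iter ρ k x))) (filter-length-iter Q? k)

  window-count : ∀ {Q : Pred X 0ℓ} (Q? : Decidable Q) n →
    (∀ {x} → x ∈ A → ExactlyOneBelow n (λ k → Q (iter ρ k x))) →
    n * length (filter Q? A) ≡ length A
  window-count Q? n one-per-window = begin
      n * length (filter Q? A)
    ≡⟨ sumBelow-const n _ ⟨
      sumBelow n (λ _ → length (filter Q? A))
    ≡⟨ sumBelow-cong n (λ k → filter-length-iter Q? k) ⟨
      sumBelow n (λ k → length (filter (λ x → Q? (iter ρ k x)) A))
    ≡⟨ count-by-parts (λ k x → Q? (iter ρ k x)) n A
         (λ x∈ → count-exactly-one (λ k → Q? (iter ρ k _)) n (one-per-window x∈)) ⟩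
      length A ∎
    where open ≡-Reasoning

+-cancel-≤⇔ : ∀ {a b a′ b′} c → a + c ≡ a′ → b + c ≡ b′ → (a ≤ b) ⇔ (a′ ≤ b′)
+-cancel-≤⇔ c refl refl = mk⇔ (+-monoˡ-≤ c) (+-cancelʳ-≤ c _ _)

+-cancel-<⇔ : ∀ {a b a′ b′} c → a + c ≡ a′ → b + c ≡ b′ → (a < b) ⇔ (a′ < b′)
+-cancel-<⇔ c e₁ e₂ = +-cancel-≤⇔ c (cong suc e₁) e₂

module CycleLemma (s : ℕ) where

  prefix : List ℕ → ℕ → ℕ
  prefix v j = sum (take j v)

  -- Comparisons of the height  h(j) = prefix v j - s·j  with subtraction cleared:
  -- Lt v k j means h(k) < h(j) and Le v k j means h(k) ≤ h(j).
  Lt Le : List ℕ → ℕ → ℕ → Set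
  Lt v k j = prefix v k + s * j < prefix v j + s * k
  Le v k j = prefix v k + s * j ≤ prefix v j + s * k

  FirstMinBelow : List ℕ → ℕ → ℕ → Set
  FirstMinBelow v N k = (k < N) × (∀ j → j < k → Lt v k j) × (∀ j → k < j → j < N → Le v k j)

  FirstMin : List ℕ → ℕ → Set
  FirstMin v = FirstMinBelow v (length v)

  Balanced : List ℕ → Set
  Balanced v = sum v + 1 ≡ s * length v

  height-trans : ∀ {p q r x y z} → p + y < q + x → q + z ≤ r + y → p + z < r + x
  height-trans {p} {q} {r} {x} {y} {z} h₁ h₂ =
    from (+-cancel-<⇔ (q + y) (regroupˡ p q y z) (regroupʳ q r x y)) (+-mono-<-≤ h₁ h₂)
    where
    regroupˡ : ∀ p q y z → p + z + (q + y) ≡ p + y + (q + z)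
    regroupˡ = solve-∀
    regroupʳ : ∀ q r x y → r + x + (q + y) ≡ q + x + (r + y)
    regroupʳ = solve-∀

  lt-le-trans : ∀ v a b c → Lt v a b → Le v b c → Lt v a c
  lt-le-trans v a b c = height-trans {prefix v a} {prefix v b} {prefix v c} {s * a} {s * b} {s * c}

  lt-trans : ∀ v a b c → Lt v a b → Lt v b c → Lt v a c
  lt-trans v a b c h₁ h₂ = lt-le-trans v a b c h₁ (<⇒≤ h₂)

  -- the first minimum is unique: each of two candidates would be strictly below the other
  firstMin-unique : ∀ v {k k′} → FirstMin v k → FirstMin v k′ → k ≡ k′
  firstMin-unique v {k} {k′} (k<n , left , right) (k′<n , left′ , right′) with <-cmp k k′
  ... | tri≈ _ k≡k′ _ = k≡k′
  ... | tri< k<k′ _ _ = ⊥-elim (<-irrefl refl (<-≤-trans (left′ k k<k′) (right k′ k<k′ k′<n)))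
  ... | tri> _ _ k′<k = ⊥-elim (<-irrefl refl (<-≤-trans (left k′ k′<k) (right′ k k′<k k<n)))

  -- scan the positions one by one, moving to the new one if it is strictly lower
  firstMinBelow-exists : ∀ v N → Σ ℕ (FirstMinBelow v (suc N))
  firstMinBelow-exists v zero = 0 , s≤s z≤n , (λ j ()) , (λ { j (s≤s _) (s≤s ()) })
  firstMinBelow-exists v (suc N) with firstMinBelow-exists v N
  ... | m , m<N , left , right with (prefix v m + s * suc N) ≤? (prefix v (suc N) + s * m)
  ...   | yes m≤N = m , m<n⇒m<1+n m<N , left , right′
    where
    right′ : ∀ j → m < j → j < suc (suc N) → Le v m j
    right′ j m<j j<N+2 with m<1+n⇒m<n∨m≡n j<N+2
    ... | inj₁ j<N+1 = right j m<j j<N+1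
    ... | inj₂ refl  = m≤N
  ...   | no m≰N = suc N , ≤-refl , left′ , λ { j N<j (s≤s j≤N) → ⊥-elim (<-irrefl refl (<-≤-trans N<j j≤N)) }
    where
    N<m : Lt v (suc N) m
    N<m = ≰⇒> m≰N
    left′ : ∀ j → j < suc N → Lt v (suc N) j
    left′ j j<N+1 with <-cmp j m
    ... | tri< j<m _ _  = lt-trans v (suc N) m j N<m (left j j<m)
    ... | tri≈ _ refl _ = N<m
    ... | tri> _ _ m<j  = lt-le-trans v (suc N) m j N<m (right j m<j j<N+1)

  firstMin-exists : ∀ v → 0 < length v → Σ ℕ (FirstMin v)
  firstMin-exists (x ∷ xs) _ = firstMinBelow-exists (x ∷ xs) (length xs)

  -- The heights at positions 0, ..., n'-1 of r = xs ++ [ x ]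
  -- are those at 1, ..., n' of v = x ∷ xs shifted by the constant s - x; by
  -- balance, the height at position n' of r is (shifted) one below that at
  -- position 0 of v, which is why the comparisons with it flip from ≤ to <.
  module RotationStep (x : ℕ) (xs : List ℕ) (balanced : Balanced (x ∷ xs)) where
    n′ : ℕ
    n′ = length xs
    v r : List ℕ
    v = x ∷ xs
    r = xs ++ [ x ]

    prefix-r : ∀ {j} → j ≤ n′ → prefix r j ≡ prefix xs j
    prefix-r {j} j≤n′ = cong sum (take-++ˡ j xs [ x ] j≤n′)

    length-r : length r ≡ suc n′
    length-r = length-rot v

    shift : ∀ p j → p + s * j + (x + s) ≡ x + p + s * suc j
    shift p j = trans (regroup p j x s) (cong (x + p +_) (sym (*-suc s j)))
      where
      regroup : ∀ p j x s → p + s * j + (x + s) ≡ x + p + (s + s * j)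
      regroup = solve-∀

    lt-shift : ∀ k j → k ≤ n′ → j ≤ n′ → Lt r k j ⇔ Lt v (suc k) (suc j)
    lt-shift k j k≤n′ j≤n′ rewrite prefix-r k≤n′ | prefix-r j≤n′ =
      +-cancel-<⇔ (x + s) (shift (prefix xs k) j) (shift (prefix xs j) k)

    le-shift : ∀ k j → k ≤ n′ → j ≤ n′ → Le r k j ⇔ Le v (suc k) (suc j)
    le-shift k j k≤n′ j≤n′ rewrite prefix-r k≤n′ | prefix-r j≤n′ =
      +-cancel-≤⇔ (x + s) (shift (prefix xs k) j) (shift (prefix xs j) k)

    le-wrap : ∀ k → k ≤ n′ → Le r k n′ ⇔ Lt v (suc k) 0
    le-wrap k k≤n′
      rewrite prefix-r k≤n′ | prefix-r (≤-refl {n′}) | take-all n′ xs ≤-refl | *-zeroʳ s | +-identityʳ (x + prefix xs k) =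
      ⇔.trans (+-cancel-≤⇔ (x + 1) lhs rhs) (⇔.sym (+-cancel-≤⇔ (s * n′) refl refl))
      where
      lhs : prefix xs k + s * n′ + (x + 1) ≡ suc (x + prefix xs k) + s * n′
      lhs = regroup (prefix xs k) (s * n′) x
        where
        regroup : ∀ p q x → p + q + (x + 1) ≡ suc (x + p) + q
        regroup = solve-∀
      rhs : sum xs + s * k + (x + 1) ≡ s * suc k + s * n′
      rhs = begin
          sum xs + s * k + (x + 1)  ≡⟨ regroup (sum xs) (s * k) x ⟩
          x + sum xs + 1 + s * k    ≡⟨ cong (_+ s * k) balanced ⟩
          s * suc n′ + s * k        ≡⟨ *-distribˡ-+ s (suc n′) k ⟨
          s * (suc n′ + k)          ≡⟨ cong (s *_) (+-comm (suc n′) k) ⟩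
          s * (k + suc n′)          ≡⟨ cong (s *_) (+-suc k n′) ⟩
          s * (suc k + n′)          ≡⟨ *-distribˡ-+ s (suc k) n′ ⟩
          s * suc k + s * n′        ∎
        where
        open ≡-Reasoning
        regroup : ∀ p q x → p + q + (x + 1) ≡ x + p + 1 + q
        regroup = solve-∀

    rot-firstMin : ∀ k → k < n′ → FirstMin r k ⇔ FirstMin v (suc k)
    rot-firstMin k k<n′ = mk⇔ forward backward
      where
      k≤n′ : k ≤ n′
      k≤n′ = <⇒≤ k<n′
      forward : FirstMin r k → FirstMin v (suc k)
      forward (_ , left , right) = s≤s k<n′ , left′ , right′
        where
        left′ : ∀ j → j < suc k → Lt v (suc k) j
        left′ zero    _         = to (le-wrap k k≤n′) (right n′ k<n′ (subst (n′ <_) (sym length-r) ≤-refl))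
        left′ (suc j) (s≤s j<k) = to (lt-shift k j k≤n′ (≤-trans (<⇒≤ j<k) k≤n′)) (left j j<k)
        right′ : ∀ j → suc k < j → j < suc n′ → Le v (suc k) j
        right′ (suc j) (s≤s k<j) (s≤s j<n′) =
          to (le-shift k j k≤n′ (<⇒≤ j<n′)) (right j k<j (subst (j <_) (sym length-r) (m<n⇒m<1+n j<n′)))
      backward : FirstMin v (suc k) → FirstMin r k
      backward (_ , left′ , right′) = subst (k <_) (sym length-r) (m<n⇒m<1+n k<n′) , left , right
        where
        left : ∀ j → j < k → Lt r k j
        left j j<k = from (lt-shift k j k≤n′ (≤-trans (<⇒≤ j<k) k≤n′)) (left′ (suc j) (s≤s j<k))
        right : ∀ j → k < j → j < length r → Le r k j
        right j k<j j<r with m<1+n⇒m<n∨m≡n (subst (j <_) length-r j<r)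
        ... | inj₁ j<n′ = from (le-shift k j k≤n′ (<⇒≤ j<n′)) (right′ (suc j) (s≤s k<j) (s≤s j<n′))
        ... | inj₂ refl = from (le-wrap k k≤n′) (left′ 0 (s≤s z≤n))

  iter-rot-firstMin : ∀ k v → Balanced v → k < length v → FirstMin (iter rot k v) 0 ⇔ FirstMin v k
  iter-rot-firstMin zero    v        _        _         = ⇔.refl
  iter-rot-firstMin (suc k) (x ∷ xs) balanced (s≤s k<n) =
    ⇔.trans (iter-rot-firstMin k (rot (x ∷ xs)) balanced′ (subst (k <_) (sym (length-rot (x ∷ xs))) (m<n⇒m<1+n k<n)))
            (RotationStep.rot-firstMin x xs balanced k k<n)
    where
    balanced′ : Balanced (rot (x ∷ xs))
    balanced′ = trans (cong (_+ 1) (sum-rot (x ∷ xs))) (trans balanced (cong (s *_) (sym (length-rot (x ∷ xs)))))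

  -- Every proper prefix sum of v, offset by x, is at least m + s·j.  The
  -- offsets carry the weights and multiples of s already passed when the
  -- condition is checked one weight at a time.
  PrefixesAbove : ℕ → ℕ → List ℕ → Set
  PrefixesAbove x m v = ∀ j → 0 < j → j < length v → m + s * j ≤ x + prefix v j

  prefixesAbove-singleton : ∀ x m w → PrefixesAbove x m [ w ]
  prefixesAbove-singleton x m w j (s≤s _) (s≤s ())

  prefixesAbove-cons : ∀ x m w w′ ws →
    PrefixesAbove x m (w ∷ w′ ∷ ws) ⇔ ((m + s ≤ x + w) × PrefixesAbove (x + w) (m + s) (w′ ∷ ws))
  prefixesAbove-cons x m w w′ ws = mk⇔ forward backward
    where
    first : (m + s * 1 ≤ x + (w + 0)) ⇔ (m + s ≤ x + w)
    first = +-cancel-≤⇔ 0 (trans (+-identityʳ _) (cong (m +_) (*-identityʳ s)))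
                          (trans (+-identityʳ _) (cong (x +_) (+-identityʳ w)))
    later : ∀ j → (m + s * suc j ≤ x + (w + prefix (w′ ∷ ws) j)) ⇔ (m + s + s * j ≤ x + w + prefix (w′ ∷ ws) j)
    later j = +-cancel-≤⇔ 0 (trans (+-identityʳ _) (trans (cong (m +_) (*-suc s j)) (sym (+-assoc m s (s * j)))))
                            (trans (+-identityʳ _) (sym (+-assoc x w _)))
    forward : PrefixesAbove x m (w ∷ w′ ∷ ws) → (m + s ≤ x + w) × PrefixesAbove (x + w) (m + s) (w′ ∷ ws)
    forward above = to first (above 1 (s≤s z≤n) (s≤s (s≤s z≤n))) ,
                    λ j 0<j j<n → to (later j) (above (suc j) (s≤s z≤n) (s≤s j<n))
    backward : (m + s ≤ x + w) × PrefixesAbove (x + w) (m + s) (w′ ∷ ws) → PrefixesAbove x m (w ∷ w′ ∷ ws)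
    backward (le , above) (suc zero)    _ _         = from first le
    backward (le , above) (suc (suc j)) _ (s≤s j<n) = from (later (suc j)) (above (suc j) (s≤s z≤n) j<n)

  -- all proper prefix sums are ≥ s·j iff the height never drops below h(0) = 0,
  -- i.e. iff the first minimum is at 0
  prefixesAbove⇔firstMin : ∀ v → 0 < length v → PrefixesAbove 0 0 v ⇔ FirstMin v 0
  prefixesAbove⇔firstMin v 0<n =
    mk⇔ (λ above → 0<n , (λ j ()) , λ j 0<j j<n → to (pad j) (above j 0<j j<n))
        (λ { (_ , _ , right) j 0<j j<n → from (pad j) (right j 0<j j<n) })
    where
    pad : ∀ j → (s * j ≤ prefix v j) ⇔ (s * j ≤ prefix v j + s * 0)
    pad j = +-cancel-≤⇔ 0 (+-identityʳ _) (cong (prefix v j +_) (sym (*-zeroʳ s)))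

#R-++ : ∀ P Q → #R (P ++ Q) ≡ #R P + #R Q
#R-++ []      Q = refl
#R-++ (U ∷ P) Q = #R-++ P Q
#R-++ (R ∷ P) Q = cong suc (#R-++ P Q)

#U-++ : ∀ P Q → #U (P ++ Q) ≡ #U P + #U Q
#U-++ []      Q = refl
#U-++ (R ∷ P) Q = #U-++ P Q
#U-++ (U ∷ P) Q = cong suc (#U-++ P Q)

join : List Path → Path
join []            = []
join (K ∷ [])      = K
join (K ∷ K′ ∷ Ks) = K ++ U ∷ join (K′ ∷ Ks)

#R-join : ∀ Ks → #R (join Ks) ≡ sum (map #R Ks)
#R-join []            = refl
#R-join (K ∷ [])      = sym (+-identityʳ (#R K))
#R-join (K ∷ K′ ∷ Ks) = trans (#R-++ K (U ∷ join (K′ ∷ Ks))) (cong (#R K +_) (#R-join (K′ ∷ Ks)))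

module Chunks (t′ : ℕ) where

  t : ℕ
  t = suc t′

  -- splitAtUp k P = (the part before the (k+1)-th up step , the part after it)
  splitAtUp : ℕ → Path → Path × Path
  splitAtUp k       []      = [] , []
  splitAtUp k       (R ∷ P) = map₁ (R ∷_) (splitAtUp k P)
  splitAtUp zero    (U ∷ P) = [] , P
  splitAtUp (suc k) (U ∷ P) = map₁ (U ∷_) (splitAtUp k P)

  splitAtUp-++ : ∀ k K Q → #U K ≡ k → splitAtUp k (K ++ U ∷ Q) ≡ (K , Q)
  splitAtUp-++ zero    []      Q refl = refl
  splitAtUp-++ k       (R ∷ K) Q e rewrite splitAtUp-++ k K Q e = refl
  splitAtUp-++ (suc k) (U ∷ K) Q e rewrite splitAtUp-++ k K Q (suc-injective e) = refl

  splitAtUp-spec : ∀ k P → k < #U P →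
    (P ≡ proj₁ (splitAtUp k P) ++ U ∷ proj₂ (splitAtUp k P)) × (#U (proj₁ (splitAtUp k P)) ≡ k)
  splitAtUp-spec k       (R ∷ P) k<U       = let (e₁ , e₂) = splitAtUp-spec k P k<U in cong (R ∷_) e₁ , e₂
  splitAtUp-spec zero    (U ∷ P) _         = refl , refl
  splitAtUp-spec (suc k) (U ∷ P) (s≤s k<U) = let (e₁ , e₂) = splitAtUp-spec k P k<U in cong (U ∷_) e₁ , cong suc e₂

  -- chunks m P: cut P at its up steps number t, 2t, ..., mt into m+1 pieces
  chunks : ℕ → Path → List Path
  chunks zero    P = [ P ]
  chunks (suc m) P = proj₁ (splitAtUp t′ P) ∷ chunks m (proj₂ (splitAtUp t′ P))

  Chunked : List Path → Set
  Chunked = All (λ K → #U K ≡ t′)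

  length-chunks : ∀ m P → length (chunks m P) ≡ suc m
  length-chunks zero    P = refl
  length-chunks (suc m) P = cong suc (length-chunks m _)

  #U-rest : ∀ m P → #U P ≡ t′ + suc m * t →
    (t′ < #U P) × (#U (proj₂ (splitAtUp t′ P)) ≡ t′ + m * t)
  #U-rest m P e = t′<U , suc-injective (+-cancelˡ-≡ t′ _ _ (begin
      t′ + suc (#U Q)        ≡⟨ cong (_+ suc (#U Q)) (sym (proj₂ spec)) ⟩
      #U K + suc (#U Q)      ≡⟨ #U-++ K (U ∷ Q) ⟨
      #U (K ++ U ∷ Q)        ≡⟨ cong #U (proj₁ spec) ⟨
      #U P                   ≡⟨ e ⟩
      t′ + suc m * t         ∎))
    where
    open ≡-Reasoning
    t′<U : t′ < #U P
    t′<U = subst (t′ <_) (sym e) (m<m+n t′ (s≤s z≤n))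
    K Q : Path
    K = proj₁ (splitAtUp t′ P)
    Q = proj₂ (splitAtUp t′ P)
    spec : (P ≡ K ++ U ∷ Q) × (#U K ≡ t′)
    spec = splitAtUp-spec t′ P t′<U

  chunks-chunked : ∀ m P → #U P ≡ t′ + m * t → Chunked (chunks m P)
  chunks-chunked zero    P e = trans e (+-identityʳ t′) ∷ []
  chunks-chunked (suc m) P e =
    let (t′<U , e′) = #U-rest m P e in proj₂ (splitAtUp-spec t′ P t′<U) ∷ chunks-chunked m _ e′

  join-chunks : ∀ m P → #U P ≡ t′ + m * t → join (chunks m P) ≡ P
  join-chunks zero    P e = refl
  join-chunks (suc m) P e = begin
      join (K ∷ chunks m Q)       ≡⟨ join-∷ m ⟩
      K ++ U ∷ join (chunks m Q)  ≡⟨ cong (λ Q′ → K ++ U ∷ Q′) (join-chunks m Q (proj₂ (#U-rest m P e))) ⟩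
      K ++ U ∷ Q                  ≡⟨ proj₁ (splitAtUp-spec t′ P (proj₁ (#U-rest m P e))) ⟨
      P                           ∎
    where
    open ≡-Reasoning
    K Q : Path
    K = proj₁ (splitAtUp t′ P)
    Q = proj₂ (splitAtUp t′ P)
    join-∷ : ∀ m → join (K ∷ chunks m Q) ≡ K ++ U ∷ join (chunks m Q)
    join-∷ zero    = refl
    join-∷ (suc m) = refl

  chunks-join : ∀ m Ks → length Ks ≡ suc m → Chunked Ks → chunks m (join Ks) ≡ Ks
  chunks-join zero    (K ∷ [])      refl _          = refl
  chunks-join (suc m) (K ∷ K′ ∷ Ks) e    (#UK ∷ ch) rewrite splitAtUp-++ t′ K (join (K′ ∷ Ks)) #UK =
    cong (K ∷_) (chunks-join m (K′ ∷ Ks) (suc-injective e) ch)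

  #U-join : ∀ m Ks → length Ks ≡ suc m → Chunked Ks → #U (join Ks) ≡ t′ + m * t
  #U-join zero    (K ∷ [])      refl (#UK ∷ []) = trans #UK (sym (+-identityʳ t′))
  #U-join (suc m) (K ∷ K′ ∷ Ks) e    (#UK ∷ ch) =
    trans (#U-++ K (U ∷ join (K′ ∷ Ks))) (cong₂ (λ p q → p + suc q) #UK (#U-join m (K′ ∷ Ks) (suc-injective e) ch))

upXs-++ : ∀ x P Q → upXsFrom x (P ++ Q) ≡ upXsFrom x P ++ upXsFrom (x + #R P) Q
upXs-++ x []      Q = cong (λ y → upXsFrom y Q) (sym (+-identityʳ x))
upXs-++ x (U ∷ P) Q = cong (x ∷_) (upXs-++ x P Q)
upXs-++ x (R ∷ P) Q =
  trans (upXs-++ (suc x) P Q) (cong (λ y → upXsFrom (suc x) P ++ upXsFrom y Q) (sym (+-suc x (#R P))))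

upXs-U++ : ∀ x k P → upXsFrom x (replicate k U ++ P) ≡ replicate k x ++ upXsFrom x P
upXs-U++ x zero    P = refl
upXs-U++ x (suc k) P = cong (x ∷_) (upXs-U++ x k P)

upXs-R++ : ∀ x k P → upXsFrom x (replicate k R ++ P) ≡ upXsFrom (x + k) P
upXs-R++ x zero    P = cong (λ y → upXsFrom y P) (sym (+-identityʳ x))
upXs-R++ x (suc k) P = trans (upXs-R++ (suc x) k P) (cong (λ y → upXsFrom y P) (sym (+-suc x k)))

length-upXs : ∀ x P → length (upXsFrom x P) ≡ #U P
length-upXs x []      = refl
length-upXs x (U ∷ P) = cong suc (length-upXs x P)
length-upXs x (R ∷ P) = length-upXs (suc x) P

upXs-above : ∀ {m x} P → m ≤ x → upXsFrom x P ≼ replicate (#U P) m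
upXs-above []      m≤x = tt
upXs-above (U ∷ P) m≤x = m≤x , upXs-above P m≤x
upXs-above (R ∷ P) m≤x = upXs-above P (m≤n⇒m≤1+n m≤x)

≼-++ : ∀ xs ys xs′ ys′ → length xs ≡ length ys → ((xs ++ xs′) ≼ (ys ++ ys′)) ⇔ ((xs ≼ ys) × (xs′ ≼ ys′))
≼-++ []       []       xs′ ys′ _ = mk⇔ (tt ,_) proj₂
≼-++ (x ∷ xs) (y ∷ ys) xs′ ys′ e =
  let split = ≼-++ xs ys xs′ ys′ (suc-injective e) in
  mk⇔ (λ { (y≤x , rest) → let (below , below′) = to split rest in (y≤x , below) , below′ })
      (λ { ((y≤x , below) , below′) → y≤x , from split (below , below′) })

_≼?_ : (xs ys : List ℕ) → Dec (xs ≼ ys)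
[]       ≼? ys       = yes tt
(x ∷ xs) ≼? []       = no (λ ())
(x ∷ xs) ≼? (y ∷ ys) = (y ≤? x) ×-dec (xs ≼? ys)

module Staircase (s′ t′ : ℕ) where
  open Chunks t′
  open CycleLemma (suc s′)

  s : ℕ
  s = suc s′

  block : Path
  block = replicate s R ++ replicate t U

  -- after its first t' up steps the staircase (started at x = m) has t up steps at each of m+s, ..., m+ks
  stairXs : ℕ → ℕ → List ℕ
  stairXs m zero    = []
  stairXs m (suc k) = replicate t (m + s) ++ stairXs (m + s) k

  upXs-stair-tail : ∀ m k → upXsFrom m (concat (replicate k block) ++ replicate s′ R) ≡ stairXs m k
  upXs-stair-tail m zero    = trans (cong (upXsFrom m) (sym (++-identityʳ (replicate s′ R)))) (upXs-R++ m s′ [])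
  upXs-stair-tail m (suc k) = begin
      upXsFrom m ((block ++ concat (replicate k block)) ++ replicate s′ R)
    ≡⟨ cong (upXsFrom m) (trans (++-assoc block _ _) (++-assoc (replicate s R) _ _)) ⟩
      upXsFrom m (replicate s R ++ replicate t U ++ tail)
    ≡⟨ upXs-R++ m s _ ⟩
      upXsFrom (m + s) (replicate t U ++ tail)
    ≡⟨ upXs-U++ (m + s) t tail ⟩
      replicate t (m + s) ++ upXsFrom (m + s) tail
    ≡⟨ cong (replicate t (m + s) ++_) (upXs-stair-tail (m + s) k) ⟩
      stairXs m (suc k) ∎
    where
    open ≡-Reasoning
    tail : Path
    tail = concat (replicate k block) ++ replicate s′ R

  upXs-staircase : ∀ n′ → upXs (staircase s t (suc n′)) ≡ replicate t′ 0 ++ stairXs 0 n′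
  upXs-staircase n′ = trans (upXs-U++ 0 t′ _) (cong (replicate t′ 0 ++_) (upXs-stair-tail 0 n′))

  chunk-beneath : ∀ {x m} K → #U K ≡ t′ → m ≤ x → upXsFrom x K ≼ replicate t′ m
  chunk-beneath {x} {m} K #UK m≤x = subst (λ u → upXsFrom x K ≼ replicate u m) #UK (upXs-above K m≤x)

  -- Chunk by chunk: the up steps inside a chunk are never a problem, and the
  -- up step separating it from the next chunk lies at x + w where the
  -- staircase has its up steps at m + s; compare with prefixesAbove-cons.
  join-beneath⇔ : ∀ k Ks x m → length Ks ≡ suc k → Chunked Ks → m ≤ x →
    (upXsFrom x (join Ks) ≼ (replicate t′ m ++ stairXs m k)) ⇔ PrefixesAbove x m (map #R Ks)
  join-beneath⇔ zero (K ∷ []) x m refl (#UK ∷ []) m≤x rewrite ++-identityʳ (replicate t′ m) =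
    mk⇔ (λ _ → prefixesAbove-singleton x m (#R K)) (λ _ → chunk-beneath K #UK m≤x)
  join-beneath⇔ (suc k) (K ∷ K′ ∷ Ks) x m e (#UK ∷ chunked) m≤x rewrite upXs-++ x K (U ∷ join (K′ ∷ Ks)) =
    mk⇔ (λ below → let (_ , le , rest) = to split below in from cons (le , to (rest⇔ le) rest))
        (λ above → let (le , above′) = to cons above in from split (chunk-beneath K #UK m≤x , le , from (rest⇔ le) above′))
    where
    split : ((upXsFrom x K ++ (x + #R K) ∷ upXsFrom (x + #R K) (join (K′ ∷ Ks))) ≼ (replicate t′ m ++ stairXs m (suc k)))
              ⇔ ((upXsFrom x K ≼ replicate t′ m)
                 × (((x + #R K) ∷ upXsFrom (x + #R K) (join (K′ ∷ Ks))) ≼ ((m + s) ∷ (replicate t′ (m + s) ++ stairXs (m + s) k))))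
    split = ≼-++ (upXsFrom x K) (replicate t′ m) _ _
                 (trans (length-upXs x K) (trans #UK (sym (length-replicate t′))))
    cons : PrefixesAbove x m (map #R (K ∷ K′ ∷ Ks))
             ⇔ ((m + s ≤ x + #R K) × PrefixesAbove (x + #R K) (m + s) (map #R (K′ ∷ Ks)))
    cons = prefixesAbove-cons x m (#R K) (#R K′) (map #R Ks)
    rest⇔ : m + s ≤ x + #R K →
      (upXsFrom (x + #R K) (join (K′ ∷ Ks)) ≼ (replicate t′ (m + s) ++ stairXs (m + s) k))
        ⇔ PrefixesAbove (x + #R K) (m + s) (map #R (K′ ∷ Ks))
    rest⇔ le = join-beneath⇔ k (K′ ∷ Ks) (x + #R K) (m + s) (suc-injective e) chunked le

  beneath⇔firstMin : ∀ n′ P → #U P ≡ t′ + n′ * t →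
    WeaklyBeneath P (staircase s t (suc n′)) ⇔ FirstMin (map #R (chunks n′ P)) 0
  beneath⇔firstMin n′ P e =
    subst (λ Q → (upXs Q ≼ upXs (staircase s t (suc n′))) ⇔ FirstMin (map #R Ks) 0) (join-chunks n′ P e)
      (subst (λ ys → (upXs (join Ks) ≼ ys) ⇔ FirstMin (map #R Ks) 0) (sym (upXs-staircase n′))
        (⇔.trans (join-beneath⇔ n′ Ks 0 0 (length-chunks n′ P) (chunks-chunked n′ P e) z≤n)
                 (prefixesAbove⇔firstMin (map #R Ks) 0<n)))
    where
    Ks : List Path
    Ks = chunks n′ P
    0<n : 0 < length (map #R Ks)
    0<n = subst (0 <_) (sym (trans (length-map #R Ks) (length-chunks n′ P))) (s≤s z≤n)

module Counting (s′ t′ n′ : ℕ) where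
  open Chunks t′
  open CycleLemma (suc s′)
  open Staircase s′ t′

  n : ℕ
  n = suc n′

  -- the endpoint (a , b) = (sn - 1 , tn - 1)
  a b : ℕ
  a = n′ + s′ * n
  b = n′ + t′ * n

  -- a path to (a , b) has t' + n't up steps, so it cuts into n chunks
  b-chunked : b ≡ t′ + n′ * t
  b-chunked = regroup n′ t′
    where
    regroup : ∀ n′ t′ → n′ + t′ * suc n′ ≡ t′ + n′ * suc t′
    regroup = solve-∀

  a+b : a + b ≡ (s + t) * n ∸ 2
  a+b = sym (begin
      (s + t) * n ∸ 2        ≡⟨ cong (_∸ 2) (*-distribʳ-+ n s t) ⟩
      (suc a + suc b) ∸ 2    ≡⟨ cong (_∸ 1) (+-suc a b) ⟩
      a + b                  ∎)
    where open ≡-Reasoning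

  A : List Path
  A = paths a b

  Beneath : Path → Set
  Beneath P = WeaklyBeneath P (staircase s t n)

  beneath? : Decidable Beneath
  beneath? P = upXs P ≼? upXs (staircase s t n)

  pieces : Path → List Path
  pieces = chunks n′

  weights : Path → List ℕ
  weights P = map #R (pieces P)

  rotate : Path → Path
  rotate P = join (rot (pieces P))

  length-weights : ∀ P → length (weights P) ≡ n
  length-weights P = trans (length-map #R (pieces P)) (length-chunks n′ P)

  module _ {P : Path} (P∈A : P ∈ A) where

    #U-path : #U P ≡ t′ + n′ * t
    #U-path = trans (proj₂ (paths-sound a b P∈A)) b-chunked

    pieces-chunked : Chunked (pieces P)
    pieces-chunked = chunks-chunked n′ P #U-path

    join-pieces : join (pieces P) ≡ P
    join-pieces = join-chunks n′ P #U-path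

    sum-weights : sum (weights P) ≡ a
    sum-weights = trans (sym (#R-join (pieces P))) (trans (cong #R join-pieces) (proj₁ (paths-sound a b P∈A)))

    balanced : Balanced (weights P)
    balanced = trans (cong (_+ 1) sum-weights) (trans (+-comm a 1) (cong (s *_) (sym (length-weights P))))

    length-rot-pieces : length (rot (pieces P)) ≡ n
    length-rot-pieces = trans (length-rot (pieces P)) (length-chunks n′ P)

    rotate-closed : rotate P ∈ A
    rotate-closed = paths-complete (rotate P) (#R-rotate , #U-rotate)
      where
      open ≡-Reasoning
      #R-rotate : #R (rotate P) ≡ a
      #R-rotate = begin
        #R (join (rot (pieces P)))    ≡⟨ #R-join (rot (pieces P)) ⟩
        sum (map #R (rot (pieces P))) ≡⟨ cong sum (map-rot #R (pieces P)) ⟩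
        sum (rot (weights P))         ≡⟨ sum-rot (weights P) ⟩
        sum (weights P)               ≡⟨ sum-weights ⟩
        a                             ∎
      #U-rotate : #U (rotate P) ≡ b
      #U-rotate = trans (#U-join n′ (rot (pieces P)) length-rot-pieces (All-rot pieces-chunked)) (sym b-chunked)

    pieces-rotate : pieces (rotate P) ≡ rot (pieces P)
    pieces-rotate = chunks-join n′ (rot (pieces P)) length-rot-pieces (All-rot pieces-chunked)

  iter-rotate-closed : ∀ k {P} → P ∈ A → iter rotate k P ∈ A
  iter-rotate-closed zero    P∈A = P∈A
  iter-rotate-closed (suc k) P∈A = iter-rotate-closed k (rotate-closed P∈A)

  pieces-iter-rotate : ∀ k {P} → P ∈ A → pieces (iter rotate k P) ≡ iter rot k (pieces P)
  pieces-iter-rotate zero    P∈A = refl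
  pieces-iter-rotate (suc k) P∈A = trans (pieces-iter-rotate k (rotate-closed P∈A)) (cong (iter rot k) (pieces-rotate P∈A))

  weights-iter-rotate : ∀ k {P} → P ∈ A → weights (iter rotate k P) ≡ iter rot k (weights P)
  weights-iter-rotate k {P} P∈A =
    trans (cong (map #R) (pieces-iter-rotate k P∈A)) (iter-natural (map #R) rot rot (map-rot #R) k (pieces P))

  rotate-period : ∀ {P} → P ∈ A → iter rotate n P ≡ P
  rotate-period {P} P∈A = begin
      iter rotate n P                                 ≡⟨ join-pieces (iter-rotate-closed n P∈A) ⟨
      join (pieces (iter rotate n P))                 ≡⟨ cong join (pieces-iter-rotate n P∈A) ⟩
      join (iter rot n (pieces P))                    ≡⟨ cong (λ k → join (iter rot k (pieces P))) (length-chunks n′ P) ⟨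
      join (iter rot (length (pieces P)) (pieces P))  ≡⟨ cong join (iter-rot-length (pieces P)) ⟩
      join (pieces P)                                 ≡⟨ join-pieces P∈A ⟩
      P                                               ∎
    where open ≡-Reasoning

  beneath-iter⇔ : ∀ {P} → P ∈ A → ∀ k → k < n → Beneath (iter rotate k P) ⇔ FirstMin (weights P) k
  beneath-iter⇔ {P} P∈A k k<n =
    ⇔.trans (beneath⇔firstMin n′ (iter rotate k P) (#U-path (iter-rotate-closed k P∈A)))
            (subst (λ v → FirstMin v 0 ⇔ FirstMin (weights P) k) (sym (weights-iter-rotate k P∈A))
                   (iter-rot-firstMin k (weights P) (balanced P∈A) (subst (k <_) (sym (length-weights P)) k<n)))

  one-per-window : ∀ {P} → P ∈ A → ExactlyOneBelow n (λ k → Beneath (iter rotate k P))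
  one-per-window {P} P∈A with firstMin-exists (weights P) (subst (0 <_) (sym (length-weights P)) (s≤s z≤n))
  ... | m , first-min = m , m<n , from (beneath-iter⇔ P∈A m m<n) first-min ,
                        λ k k<n below → firstMin-unique (weights P) (to (beneath-iter⇔ P∈A k k<n) below) first-min
    where
    m<n : m < n
    m<n = subst (m <_) (length-weights P) (proj₁ first-min)

  -- double counting with the permutation ρ = rotate, whose inverse is ρⁿ⁻¹
  count : n * length (filter beneath? A) ≡ length A
  count = window-count beneath? n one-per-window
    where
    rotate-inverse : ∀ {P} → P ∈ A → rotate (iter rotate n′ P) ≡ P
    rotate-inverse {P} P∈A = trans (iter-commute rotate n′ P) (rotate-period P∈A)
    open Permutation A (paths-unique a b) rotate (iter rotate n′) rotate-closed (iter-rotate-closed n′)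
                     rotate-period rotate-inverse

theorem5 : (s t n : ℕ) → .{{_ : NonZero s}} → .{{_ : NonZero t}} → .{{_ : NonZero n}} →
    Σ (List Path) λ L →
    Unique L
    × ((P : Path) → (P ∈ L) ⇔ (EndsAt P (s * n ∸ 1) (t * n ∸ 1) × WeaklyBeneath P (staircase s t n)))
    × (n * length L ≡ ((s + t) * n ∸ 2) C (t * n ∸ 1))
theorem5 (suc s′) (suc t′) (suc n′) =
  filter beneath? A , Unique.filter⁺ beneath? (paths-unique a b) , membership , counting
  where
  open Counting s′ t′ n′
  membership : (P : Path) → (P ∈ filter beneath? A) ⇔ (EndsAt P a b × Beneath P)
  membership P = mk⇔ (λ P∈ → let (P∈A , below) = ∈-filter⁻ beneath? P∈ in paths-sound a b P∈A , below)
                     (λ { (ends , below) → ∈-filter⁺ beneath? (paths-complete P ends) below })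
  counting : n * length (filter beneath? A) ≡ ((suc s′ + suc t′) * n ∸ 2) C b
  counting = trans count (trans (paths-length a b) (cong (_C b) a+b))
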